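{- Let $\mathfrak F=\langle U,B\rangle$ be a 3-frame. Then each of the following equivalences holds, where the right-hand conditions are required for all $X,Y,Z\subseteq U$: (0) $\mathfrak F$ satisfies $B(a,a,a)$ for all $a$ iff $X\subseteq\langle B\rangle(X,X)$; (1$_f$) $\mathfrak F$ satisfies $B(a,b,c)\rightarrow B(c,b,a)$ iff $\langle B\rangle(X,Y)\subseteq\langle B\rangle(Y,X)$; (1$_g$) $\mathfrak F$ satisfies $B(a,b,c)\rightarrow B(c,b,a)$ iff $[\![B]\!](X,Y)\subseteq[\![B]\!](Y,X)$; (2) $\mathfrak F$ satisfies $B(a,b,c)\rightarrow B(a,a,b)$ iff $Y\cap\langle B\rangle(X,Z)\subseteq\langle B\rangle(X\cap\langle B\rangle(X,Y),Z)$; (3) $\mathfrak F$ satisfies $B(a,b,c)\wedge B(a,c,b)\rightarrow b=c$ iff $\langle B\rangle(X,[\![B]\!](X,-Y)\cap Y)\subseteq Y$; (W) $\mathfrak F$ satisfies $B(a,b,a)\rightarrow a=b$ iff $[\![B]\!](X,X)\subseteq X$ for all $X\neq\emptyset$; (2s) $\mathfrak F$ satisfies $B(a,a,b)$ for all $a,b$ iff $X\subseteq\langle B\rangle(X,Y)$ for all $X$ and all $Y\neq\emptyset$.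
   Context: A 3-frame is $\langle U,B\rangle$ with $U$ non-empty and $B\subseteq U^3$. For $X,Y\subseteq U$: $\langle B\rangle(X,Y)=\{u\in U\mid \exists x\in X\,\exists y\in Y\ B(x,u,y)\}$ and $[\![B]\!](X,Y)=\{u\in U\mid X\times\{u\}\times Y\subseteq B\}$. $-Y$ denotes $U\setminus Y$. The full complex algebra is $\mathsf{Cm}^{ps}(\mathfrak F)=\langle 2^U,\langle B\rangle,[\![B]\!]\rangle$. -}

module Defs where

open import Level using (0ℓ)
open import Data.Product using (∃; _×_)
open import Relation.Unary using (Pred; _∈_)

record Frame3 : Set₁ where
  field
    U        : Set
    inhabit  : U
    B        : U → U → U → Set

Sub : Set → Set₁
Sub U = Pred U 0ℓ

module _ {U : Set} (B : U → U → U → Set) where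
  ⟨_⟩ : Sub U → Sub U → Sub U
  ⟨_⟩ X Y u = ∃ λ x → ∃ λ y → x ∈ X × y ∈ Y × B x u y

  ⟦_⟧ : Sub U → Sub U → Sub U
  ⟦_⟧ X Y u = ∀ x y → x ∈ X → y ∈ Y → B x u y

-- Each frame condition is captured by instantiating the algebraic inclusion at singletons
-- ｛ a ｝, ｛ b ｝, ｛ c ｝ (or, for (3), at ｛ a ｝ and the complement of ｛ b ｝), which
-- reduces ⟨B⟩ and ⟦B⟧ to single instances of B; conversely each inclusion follows
-- pointwise from the condition. Classical logic enters only in (3), (W) and (2s): to decide
-- membership in Y, and to pick an element of a non-empty set.
module Submission where

open import Defs
open import Level using (0ℓ)
open import Data.Product using (_×_; _,_)
open import Relation.Binary.PropositionalEquality using (_≡_; refl; sym; subst)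
open import Relation.Nullary using (¬_)
open import Relation.Unary using (_⊆_; _∩_; ∁; Empty; Satisfiable; ｛_｝)
open import Function.Bundles using (_⇔_; mk⇔)
open import Axiom.ExcludedMiddle using (ExcludedMiddle)
open import Axiom.DoubleNegationElimination using (DoubleNegationElimination; em⇒dne)

nonEmpty⇒satisfiable : DoubleNegationElimination 0ℓ →
                       {U : Set} {X : Sub U} → ¬ Empty X → Satisfiable X
nonEmpty⇒satisfiable dne nonEmpty = dne (λ ¬∃ → nonEmpty (λ x x∈X → ¬∃ (x , x∈X)))

module Correspondence {U : Set} (B : U → U → U → Set) where

  Reflexive : Set
  Reflexive = ∀ a → B a a a

  Symmetric : Set
  Symmetric = ∀ a b c → B a b c → B c b a

  LeftReflexive : Set
  LeftReflexive = ∀ a b c → B a b c → B a a b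

  Antisymmetric : Set
  Antisymmetric = ∀ a b c → B a b c → B a c b → b ≡ c

  Identity : Set
  Identity = ∀ a b → B a b a → a ≡ b

  StronglyLeftReflexive : Set
  StronglyLeftReflexive = ∀ a b → B a a b

  ⟨⟩-singleton⁺ : ∀ {a b c} → B a b c → ⟨ B ⟩ ｛ a ｝ ｛ c ｝ b
  ⟨⟩-singleton⁺ {a} {c = c} Babc = a , c , refl , refl , Babc

  ⟨⟩-singleton⁻ : ∀ {a b c} → ⟨ B ⟩ ｛ a ｝ ｛ c ｝ b → B a b c
  ⟨⟩-singleton⁻ (_ , _ , refl , refl , Babc) = Babc

  ⟦⟧-singleton⁺ : ∀ {a b c} → B a b c → ⟦ B ⟧ ｛ a ｝ ｛ c ｝ b
  ⟦⟧-singleton⁺ Babc _ _ refl refl = Babc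

  reflexive⇔diagonal-⊆ : Reflexive ⇔ (∀ (X : Sub U) → X ⊆ ⟨ B ⟩ X X)
  reflexive⇔diagonal-⊆ = mk⇔
    (λ refl₃ X {x} x∈X → x , x , x∈X , x∈X , refl₃ x)
    (λ ⊆diag a → ⟨⟩-singleton⁻ (⊆diag ｛ a ｝ refl))

  symmetric⇔⟨⟩-comm : Symmetric ⇔ (∀ (X Y : Sub U) → ⟨ B ⟩ X Y ⊆ ⟨ B ⟩ Y X)
  symmetric⇔⟨⟩-comm = mk⇔
    (λ sym₃ X Y {_} (x , y , x∈X , y∈Y , Bxuy) → y , x , y∈Y , x∈X , sym₃ _ _ _ Bxuy)
    (λ comm a b c Babc → ⟨⟩-singleton⁻ (comm ｛ a ｝ ｛ c ｝ (⟨⟩-singleton⁺ Babc)))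

  symmetric⇔⟦⟧-comm : Symmetric ⇔ (∀ (X Y : Sub U) → ⟦ B ⟧ X Y ⊆ ⟦ B ⟧ Y X)
  symmetric⇔⟦⟧-comm = mk⇔
    (λ sym₃ X Y {_} u∈⟦X,Y⟧ y x y∈Y x∈X → sym₃ _ _ _ (u∈⟦X,Y⟧ x y x∈X y∈Y))
    (λ comm a b c Babc → comm ｛ a ｝ ｛ c ｝ (⟦⟧-singleton⁺ Babc) c a refl refl)

  leftReflexive⇔⟨⟩-absorb :
    LeftReflexive ⇔ (∀ (X Y Z : Sub U) → Y ∩ ⟨ B ⟩ X Z ⊆ ⟨ B ⟩ (X ∩ ⟨ B ⟩ X Y) Z)
  leftReflexive⇔⟨⟩-absorb = mk⇔
    (λ leftRefl X Y Z {u} (u∈Y , x , z , x∈X , z∈Z , Bxuz) →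
       x , z , (x∈X , x , u , x∈X , u∈Y , leftRefl _ _ _ Bxuz) , z∈Z , Bxuz)
    (λ absorb a b c Babc → extract (absorb ｛ a ｝ ｛ b ｝ ｛ c ｝ (refl , ⟨⟩-singleton⁺ Babc)))
    where
    extract : ∀ {a b c} → ⟨ B ⟩ (｛ a ｝ ∩ ⟨ B ⟩ ｛ a ｝ ｛ b ｝) ｛ c ｝ b → B a a b
    extract (_ , _ , (refl , a∈⟨a,b⟩) , _) = ⟨⟩-singleton⁻ a∈⟨a,b⟩

  antisymmetric⇔⟨⟩⟦⟧-⊆ : DoubleNegationElimination 0ℓ →
    Antisymmetric ⇔ (∀ (X Y : Sub U) → ⟨ B ⟩ X (⟦ B ⟧ X (∁ Y) ∩ Y) ⊆ Y)
  antisymmetric⇔⟨⟩⟦⟧-⊆ dne = mk⇔ ⇒ ⇐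
    where
    ⇒ : Antisymmetric → ∀ X Y → ⟨ B ⟩ X (⟦ B ⟧ X (∁ Y) ∩ Y) ⊆ Y
    ⇒ antisym X Y {u} (x , v , x∈X , (v∈⟦X,∁Y⟧ , v∈Y) , Bxuv) = dne λ u∉Y →
      u∉Y (subst Y (sym (antisym x u v Bxuv (v∈⟦X,∁Y⟧ x u x∈X u∉Y))) v∈Y)

    -- Take Y to be the complement of ｛ b ｝: then u ∈ ∁ Y forces u ≡ b (classically).
    ⇐ : (∀ X Y → ⟨ B ⟩ X (⟦ B ⟧ X (∁ Y) ∩ Y) ⊆ Y) → Antisymmetric
    ⇐ ⊆Y a b c Babc Bacb = dne λ b≢c →
      ⊆Y ｛ a ｝ (∁ ｛ b ｝) (a , c , refl , (c∈⟦a,b⟧ , b≢c) , Babc) refl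
      where
      c∈⟦a,b⟧ : ⟦ B ⟧ ｛ a ｝ (∁ (∁ ｛ b ｝)) c
      c∈⟦a,b⟧ _ y refl y∈∁∁b with dne y∈∁∁b
      ... | refl = Bacb

  identity⇔⟦⟧-diagonal-⊆ : DoubleNegationElimination 0ℓ →
    Identity ⇔ (∀ (X : Sub U) → ¬ Empty X → ⟦ B ⟧ X X ⊆ X)
  identity⇔⟦⟧-diagonal-⊆ dne = mk⇔
    (λ identity X nonEmpty {u} u∈⟦X,X⟧ →
       let (x , x∈X) = nonEmpty⇒satisfiable dne nonEmpty
       in subst X (identity x u (u∈⟦X,X⟧ x x x∈X x∈X)) x∈X)
    (λ ⊆diag a b Baba → ⊆diag ｛ a ｝ (λ a∉｛a｝ → a∉｛a｝ a refl) (⟦⟧-singleton⁺ Baba))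

  stronglyLeftReflexive⇔⊆⟨⟩ : DoubleNegationElimination 0ℓ →
    StronglyLeftReflexive ⇔ (∀ (X Y : Sub U) → ¬ Empty Y → X ⊆ ⟨ B ⟩ X Y)
  stronglyLeftReflexive⇔⊆⟨⟩ dne = mk⇔
    (λ strongRefl X Y nonEmpty {x} x∈X →
       let (y , y∈Y) = nonEmpty⇒satisfiable dne nonEmpty
       in x , y , x∈X , y∈Y , strongRefl x y)
    (λ ⊆⟨⟩ a b → ⟨⟩-singleton⁻ (⊆⟨⟩ ｛ a ｝ ｛ b ｝ (λ b∉｛b｝ → b∉｛b｝ b refl) refl))

theorem5p1 : ExcludedMiddle 0ℓ → (F : Frame3) →
    let open Frame3 F in
      ((∀ a → B a a a) ⇔ (∀ (X : Sub U) → X ⊆ ⟨ B ⟩ X X))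
    × ((∀ a b c → B a b c → B c b a) ⇔ (∀ (X Y : Sub U) → ⟨ B ⟩ X Y ⊆ ⟨ B ⟩ Y X))
    × ((∀ a b c → B a b c → B c b a) ⇔ (∀ (X Y : Sub U) → ⟦ B ⟧ X Y ⊆ ⟦ B ⟧ Y X))
    × ((∀ a b c → B a b c → B a a b)
        ⇔ (∀ (X Y Z : Sub U) → Y ∩ ⟨ B ⟩ X Z ⊆ ⟨ B ⟩ (X ∩ ⟨ B ⟩ X Y) Z))
    × ((∀ a b c → B a b c → B a c b → b ≡ c)
        ⇔ (∀ (X Y : Sub U) → ⟨ B ⟩ X (⟦ B ⟧ X (∁ Y) ∩ Y) ⊆ Y))
    × ((∀ a b → B a b a → a ≡ b) ⇔ (∀ (X : Sub U) → ¬ Empty X → ⟦ B ⟧ X X ⊆ X))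
    × ((∀ a b → B a a b) ⇔ (∀ (X Y : Sub U) → ¬ Empty Y → X ⊆ ⟨ B ⟩ X Y))
theorem5p1 em F =
    reflexive⇔diagonal-⊆
  , symmetric⇔⟨⟩-comm
  , symmetric⇔⟦⟧-comm
  , leftReflexive⇔⟨⟩-absorb
  , antisymmetric⇔⟨⟩⟦⟧-⊆ dne
  , identity⇔⟦⟧-diagonal-⊆ dne
  , stronglyLeftReflexive⇔⊆⟨⟩ dne
  where
  open Correspondence (Frame3.B F)
  dne : DoubleNegationElimination 0ℓ
  dne = em⇒dne em
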